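{- Let $G$ be a connected well-indumatched graph and let $e=uv$ be a cut-edge of $G$. If $u$ is an end vertex of a path of length at least two that does not contain $v$, then the component of $G\setminus e$ containing $v$ is well-indumatched.
   Context: All graphs are finite, simple and undirected. An induced matching of a graph $G$ is a set $M$ of edges, no two sharing an endpoint, such that no edge of $G$ joins an endpoint of one edge of $M$ to an endpoint of another edge of $M$. A graph is well-indumatched if all of its inclusion-wise maximal induced matchings have the same size. A cut-edge is an edge whose removal increases the number of connected components. -}

module Defs where

open import Data.Nat using (ℕ; _<_; _≤_)
open import Data.Fin using (Fin; toℕ)
open import Data.Bool using (Bool; true; false; _∧_; not)
open import Data.Product using (_×_; _,_; proj₁; proj₂; Σ; ∃)
open import Data.List using (List; []; _∷_; length; head; lookup)
open import Data.List.Membership.Propositional using (_∈_; _∉_)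
open import Data.List.Relation.Unary.All using (All)
open import Data.List.Relation.Unary.Unique.Propositional using (Unique)
open import Data.Maybe using (just)
open import Relation.Binary.PropositionalEquality using (_≡_; _≢_)
open import Relation.Nullary using (¬_)

record Graph (n : ℕ) : Set where
  field
    adj   : Fin n → Fin n → Bool
    sym   : ∀ x y → adj x y ≡ adj y x
    irrefl : ∀ x → adj x x ≡ false
open Graph public

Adj : ∀ {n} → Graph n → Fin n → Fin n → Set
Adj G x y = adj G x y ≡ true

_==_ : ∀ {n} → Fin n → Fin n → Bool
x == y = Data.Nat._≡ᵇ_ (toℕ x) (toℕ y)

deleteEdge : ∀ {n} → Graph n → Fin n → Fin n → Graph n
deleteEdge {n} G u v = record
  { adj = λ x y → adj G x y ∧ not (isUV x y)
  ; sym = λ x y → symProof x y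
  ; irrefl = λ x → irr x }
  where
  isUV : Fin n → Fin n → Bool
  isUV x y = ((x == u) ∧ (y == v)) Data.Bool.∨ ((x == v) ∧ (y == u))
  open import Data.Bool.Properties using (∨-comm)
  open import Relation.Binary.PropositionalEquality using (cong₂; refl)
  isUV-sym : ∀ x y → isUV x y ≡ isUV y x
  isUV-sym x y rewrite Data.Bool.Properties.∧-comm (x == u) (y == v)
                     | Data.Bool.Properties.∧-comm (x == v) (y == u)
                     = ∨-comm ((y == v) ∧ (x == u)) ((y == u) ∧ (x == v))
  symProof : ∀ x y → (adj G x y ∧ not (isUV x y)) ≡ (adj G y x ∧ not (isUV y x))
  symProof x y = cong₂ (λ a b → a ∧ not b) (Graph.sym G x y) (isUV-sym x y)
  irr : ∀ x → (adj G x x ∧ not (isUV x x)) ≡ false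
  irr x rewrite Graph.irrefl G x = refl

data Reach {n} (G : Graph n) : Fin n → Fin n → Set where
  here  : ∀ {x} → Reach G x x
  step  : ∀ {x y z} → Adj G x y → Reach G y z → Reach G x z

Connected : ∀ {n} → Graph n → Set
Connected G = ∀ x y → Reach G x y

IsCutEdge : ∀ {n} → Graph n → Fin n → Fin n → Set
IsCutEdge G u v = Adj G u v × ¬ Reach (deleteEdge G u v) u v

data IsWalk {n} (G : Graph n) : List (Fin n) → Set where
  nil  : IsWalk G []
  one  : ∀ x → IsWalk G (x ∷ [])
  cons : ∀ {x y xs} → Adj G x y → IsWalk G (y ∷ xs) → IsWalk G (x ∷ y ∷ xs)

IsPath : ∀ {n} → Graph n → List (Fin n) → Set
IsPath G p = IsWalk G p × Unique p

-- Induced matchings of the subgraph of G induced by the vertex set S.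
-- An edge is an ordered pair (a , b) with toℕ a < toℕ b (canonical
-- representative of the unordered edge {a,b}).
Edge : ℕ → Set
Edge n = Fin n × Fin n

IsEdgeIn : ∀ {n} → Graph n → (Fin n → Set) → Edge n → Set
IsEdgeIn G S (a , b) = Adj G a b × toℕ a < toℕ b × S a × S b

Separated : ∀ {n} → Graph n → Edge n → Edge n → Set
Separated G (a , b) (c , d) =
  (a ≢ c × a ≢ d × b ≢ c × b ≢ d) ×
  (¬ Adj G a c × ¬ Adj G a d × ¬ Adj G b c × ¬ Adj G b d)

IsInducedMatching : ∀ {n} → Graph n → (Fin n → Set) → List (Edge n) → Set
IsInducedMatching G S M =
  All (IsEdgeIn G S) M ×
  (∀ i j → i ≢ j → Separated G (lookup M i) (lookup M j))

IsMaximalInducedMatching : ∀ {n} → Graph n → (Fin n → Set) → List (Edge n) → Set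
IsMaximalInducedMatching G S M =
  IsInducedMatching G S M ×
  (∀ M' → IsInducedMatching G S M' → (∀ {e} → e ∈ M → e ∈ M') → ∀ {e} → e ∈ M' → e ∈ M)

WellIndumatchedOn : ∀ {n} → Graph n → (Fin n → Set) → Set
WellIndumatchedOn G S = ∀ M M' →
  IsMaximalInducedMatching G S M → IsMaximalInducedMatching G S M' →
  length M ≡ length M'

WellIndumatched : ∀ {n} → Graph n → Set
WellIndumatched G = WellIndumatchedOn G (λ _ → Data.Unit.⊤)
  where import Data.Unit

{-# OPTIONS --safe #-}
module Submission where

-- Let H be the component of v in G ∖ uv and p₁p₂ the first edge of the path from u.
-- Neither p₁ nor p₂ lies in H, and p₁ is adjacent to u, so for every maximal induced
-- matching M of H the edge p₁p₂ together with M is an induced matching of G. An edge of G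
-- compatible with it avoids u; if it met H it would lie in H and extend M, so it misses H
-- and is compatible with p₁p₂ and any induced matching of H. Hence extending p₁p₂ ∷ M
-- greedily along a fixed enumeration of the edges of G adds the same edges N whatever M
-- is, giving maximal induced matchings of G of size |M| + 1 + |N|; since G is
-- well-indumatched, all M have the same size.

open import Defs hiding (sym; irrefl)
open import Data.Bool using (Bool; true; false; _∧_; _∨_; T)
import Data.Bool as Bool
open import Data.Bool.Properties using (T-≡; T-∧; T-∨)
open import Data.Empty using (⊥; ⊥-elim)
open import Data.Fin using (Fin; toℕ; zero; suc)
open import Data.Fin.Properties using (toℕ-injective) renaming (_≟_ to _≟ᶠ_)
import Data.Fin.Properties as Fin
open import Data.List using (List; []; _∷_; _++_; length; lookup; allFin; cartesianProduct)
open import Data.List.Properties using (length-++)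
open import Data.List.Membership.Propositional using (_∈_; _∉_)
open import Data.List.Membership.Propositional.Properties
  using (∈-allFin; ∈-cartesianProduct⁺; ∈-lookup)
open import Data.List.Relation.Binary.Subset.Propositional using (_⊆_)
open import Data.List.Relation.Binary.Subset.Propositional.Properties using (xs⊆xs++ys; xs⊆x∷xs)
open import Data.List.Relation.Unary.All as All using (All; []; _∷_)
open import Data.List.Relation.Unary.All.Properties using (anti-mono; ++⁺; ++⁻)
open import Data.List.Relation.Unary.Any using (here; there)
open import Data.List.Relation.Unary.AllPairs using (AllPairs; []; _∷_)
open import Data.Nat using (_≤_; _<?_; _+_; suc; s≤s)
open import Data.Nat.Properties using (≡ᵇ⇒≡; <-cmp; +-cancelˡ-≡; suc-injective)
open import Data.Product using (_×_; _,_; proj₁; proj₂; Σ)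
open import Data.Product.Properties using (≡-dec)
open import Data.Sum using (_⊎_; inj₁; inj₂; [_,_])
import Data.Sum as Sum
open import Data.Unit using (⊤; tt)
open import Function using (_∘_; Equivalence)
open import Relation.Binary.Definitions using (Symmetric; tri<; tri≈; tri>)
open import Relation.Binary.PropositionalEquality using (_≡_; _≢_; refl; sym; trans; cong; module ≡-Reasoning)
open import Relation.Nullary using (¬_; Dec; yes; no; ¬?)
open import Relation.Nullary.Decidable using (_×-dec_)

==⇒≡ : ∀ {n} {x y : Fin n} → T (x == y) → x ≡ y
==⇒≡ {x = x} {y} t = toℕ-injective (≡ᵇ⇒≡ (toℕ x) (toℕ y) t)

LookupPairwise : {A : Set} → (A → A → Set) → List A → Set
LookupPairwise R xs = ∀ i j → i ≢ j → R (lookup xs i) (lookup xs j)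

module _ {A : Set} where

  lookup⇒All : ∀ {P : A → Set} {xs} → (∀ i → P (lookup xs i)) → All P xs
  lookup⇒All {xs = []}    _ = []
  lookup⇒All {xs = _ ∷ _} p = p zero ∷ lookup⇒All (p ∘ suc)

  module _ {R : A → A → Set} where

    lookupPairwise⇒allPairs : ∀ {xs} → LookupPairwise R xs → AllPairs R xs
    lookupPairwise⇒allPairs {[]}    _ = []
    lookupPairwise⇒allPairs {_ ∷ _} p =
      lookup⇒All (λ j → p zero (suc j) λ ()) ∷
      lookupPairwise⇒allPairs (λ i j i≢j → p (suc i) (suc j) (i≢j ∘ Fin.suc-injective))

    module _ (R-sym : Symmetric R) where

      allPairs⇒lookupPairwise : ∀ {xs} → AllPairs R xs → LookupPairwise R xs
      allPairs⇒lookupPairwise (_ ∷ _)  zero    zero    0≢0 = ⊥-elim (0≢0 refl)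
      allPairs⇒lookupPairwise (rx ∷ _) zero    (suc j) _   = All.lookup rx (∈-lookup j)
      allPairs⇒lookupPairwise (rx ∷ _) (suc i) zero    _   = R-sym (All.lookup rx (∈-lookup i))
      allPairs⇒lookupPairwise (_ ∷ r)  (suc i) (suc j) i≢j =
        allPairs⇒lookupPairwise r i j (i≢j ∘ cong suc)

      allPairs-∈ : ∀ {xs x y} → AllPairs R xs → x ∈ xs → y ∈ xs → x ≢ y → R x y
      allPairs-∈ (_ ∷ _)  (here refl) (here refl) x≢x = ⊥-elim (x≢x refl)
      allPairs-∈ (rx ∷ _) (here refl) (there y∈)  _   = All.lookup rx y∈
      allPairs-∈ (rx ∷ _) (there x∈)  (here refl) _   = R-sym (All.lookup rx x∈)
      allPairs-∈ (_ ∷ r)  (there x∈)  (there y∈)  x≢y = allPairs-∈ r x∈ y∈ x≢y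

module GraphProperties {n} (G : Graph n) where

  adj-sym : ∀ {x y} → Adj G x y → Adj G y x
  adj-sym {x} {y} a = trans (Graph.sym G y x) a

  adj-irrefl : ∀ {x y} → Adj G x y → x ≢ y
  adj-irrefl {x} a refl with trans (sym (Graph.irrefl G x)) a
  ... | ()

  adj? : ∀ x y → Dec (Adj G x y)
  adj? x y = adj G x y Bool.≟ true

  reach-snoc : ∀ {x y z} → Reach G x y → Adj G y z → Reach G x z
  reach-snoc here       a = step a here
  reach-snoc (step b r) a = step b (reach-snoc r a)

  reach-sym : ∀ {x y} → Reach G x y → Reach G y x
  reach-sym here       = here
  reach-sym (step a r) = reach-snoc (reach-sym r) (adj-sym a)

  separated-sym : Symmetric (Separated G)
  separated-sym ((a≢c , a≢d , b≢c , b≢d) , (a≁c , a≁d , b≁c , b≁d)) =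
    (a≢c ∘ sym , b≢c ∘ sym , a≢d ∘ sym , b≢d ∘ sym) ,
    (a≁c ∘ adj-sym , b≁c ∘ adj-sym , a≁d ∘ adj-sym , b≁d ∘ adj-sym)

  separated? : ∀ e e′ → Dec (Separated G e e′)
  separated? (a , b) (c , d) =
    (¬? (a ≟ᶠ c) ×-dec ¬? (a ≟ᶠ d) ×-dec ¬? (b ≟ᶠ c) ×-dec ¬? (b ≟ᶠ d)) ×-dec
    (¬? (adj? a c) ×-dec ¬? (adj? a d) ×-dec ¬? (adj? b c) ×-dec ¬? (adj? b d))

  edge? : ∀ e → Dec (IsEdgeIn G (λ _ → ⊤) e)
  edge? (a , b) = adj? a b ×-dec (toℕ a <? toℕ b) ×-dec yes tt ×-dec yes tt

  adj⇒edge : ∀ {x y} → Adj G x y → IsEdgeIn G (λ _ → ⊤) (x , y) ⊎ IsEdgeIn G (λ _ → ⊤) (y , x)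
  adj⇒edge {x} {y} a with <-cmp (toℕ x) (toℕ y)
  ... | tri< x<y _ _ = inj₁ (a , x<y , tt , tt)
  ... | tri≈ _ x≡y _ = ⊥-elim (adj-irrefl a (toℕ-injective x≡y))
  ... | tri> _ _ y<x = inj₂ (adj-sym a , y<x , tt , tt)

  IsInducedMatching′ : (Fin n → Set) → List (Edge n) → Set
  IsInducedMatching′ S M = All (IsEdgeIn G S) M × AllPairs (Separated G) M

  isInducedMatching⁺ : ∀ {S M} → IsInducedMatching′ S M → IsInducedMatching G S M
  isInducedMatching⁺ (edges , sep) = edges , allPairs⇒lookupPairwise separated-sym sep

  isInducedMatching⁻ : ∀ {S M} → IsInducedMatching G S M → IsInducedMatching′ S M
  isInducedMatching⁻ (edges , sep) = edges , lookupPairwise⇒allPairs sep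

module MaximalExtension {n} (G : Graph n) where
  open GraphProperties G
  open import Data.List.Membership.DecPropositional (≡-dec (_≟ᶠ_ {n}) (_≟ᶠ_ {n})) using (_∈?_)

  Compatible : List (Edge n) → Edge n → Set
  Compatible L e = IsEdgeIn G (λ _ → ⊤) e × All (Separated G e) L

  compatible? : ∀ L e → Dec (Compatible L e)
  compatible? L e = edge? e ×-dec All.all? (separated? e) L

  grow : List (Edge n) → List (Edge n) → List (Edge n) → List (Edge n)
  grow B []       N = N
  grow B (e ∷ es) N with compatible? (N ++ B) e
  ... | yes _ = grow B es (e ∷ N)
  ... | no _  = grow B es N

  grow-⊇ : ∀ B es N → N ⊆ grow B es N
  grow-⊇ B []       N x∈ = x∈
  grow-⊇ B (e ∷ es) N x∈ with compatible? (N ++ B) e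
  ... | yes _ = grow-⊇ B es (e ∷ N) (there x∈)
  ... | no _  = grow-⊇ B es N x∈

  grow-induced : ∀ B es N → IsInducedMatching′ (λ _ → ⊤) (N ++ B) →
                 IsInducedMatching′ (λ _ → ⊤) (grow B es N ++ B)
  grow-induced B []       N ind = ind
  grow-induced B (e ∷ es) N (edges , sep) with compatible? (N ++ B) e
  ... | yes (eE , eSep) = grow-induced B es (e ∷ N) (eE ∷ edges , eSep ∷ sep)
  ... | no _            = grow-induced B es N (edges , sep)

  compatible-anti-mono : ∀ {B N N′ e} → N ⊆ N′ → Compatible (N′ ++ B) e → Compatible (N ++ B) e
  compatible-anti-mono {B} {N} {N′} N⊆N′ (eE , eSep) =
    eE , ++⁺ (anti-mono N⊆N′ (proj₁ (++⁻ N′ eSep))) (proj₂ (++⁻ N′ eSep))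

  grow-complete : ∀ B es N {e} → e ∈ es → Compatible (grow B es N ++ B) e → e ∈ grow B es N
  grow-complete B (e ∷ es) N e∈ c with compatible? (N ++ B) e
  grow-complete B (e ∷ es) N (here refl) c | yes _ = grow-⊇ B es (e ∷ N) (here refl)
  grow-complete B (e ∷ es) N (there e∈) c  | yes _ = grow-complete B es (e ∷ N) e∈ c
  grow-complete B (e ∷ es) N (here refl) c | no ¬c =
    ⊥-elim (¬c (compatible-anti-mono (grow-⊇ B es N) c))
  grow-complete B (e ∷ es) N (there e∈) c  | no _  = grow-complete B es N e∈ c

  compatible-transfer : ∀ {B B′} →
    (∀ {e} → IsEdgeIn G (λ _ → ⊤) e → All (Separated G e) B → All (Separated G e) B′) →
    ∀ N {e} → Compatible (N ++ B) e → Compatible (N ++ B′) e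
  compatible-transfer f N (eE , eSep) = eE , ++⁺ (proj₁ (++⁻ N eSep)) (f eE (proj₂ (++⁻ N eSep)))

  grow-cong : ∀ {B₁ B₂} →
    (∀ {e} → IsEdgeIn G (λ _ → ⊤) e → All (Separated G e) B₁ → All (Separated G e) B₂) →
    (∀ {e} → IsEdgeIn G (λ _ → ⊤) e → All (Separated G e) B₂ → All (Separated G e) B₁) →
    ∀ es N → grow B₁ es N ≡ grow B₂ es N
  grow-cong {B₁} {B₂} to from []       N = refl
  grow-cong {B₁} {B₂} to from (e ∷ es) N with compatible? (N ++ B₁) e | compatible? (N ++ B₂) e
  ... | yes _ | yes _ = grow-cong to from es (e ∷ N)
  ... | no _  | no _  = grow-cong to from es N
  ... | yes c | no ¬c = ⊥-elim (¬c (compatible-transfer to N c))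
  ... | no ¬c | yes c = ⊥-elim (¬c (compatible-transfer from N c))

  allEdges : List (Edge n)
  allEdges = cartesianProduct (allFin n) (allFin n)

  ∈-allEdges : ∀ e → e ∈ allEdges
  ∈-allEdges (a , b) = ∈-cartesianProduct⁺ (∈-allFin a) (∈-allFin b)

  extend : List (Edge n) → List (Edge n)
  extend B = grow B allEdges [] ++ B

  extend-maximal : ∀ {B} → IsInducedMatching′ (λ _ → ⊤) B →
                   IsMaximalInducedMatching G (λ _ → ⊤) (extend B)
  extend-maximal {B} ind = isInducedMatching⁺ (grow-induced B allEdges [] ind) , maximal
    where
    maximal : ∀ M′ → IsInducedMatching G (λ _ → ⊤) M′ → extend B ⊆ M′ → M′ ⊆ extend B
    maximal M′ ind′ E⊆M′ {e} e∈M′ with e ∈? extend B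
    ... | yes e∈E = e∈E
    ... | no e∉E = xs⊆xs++ys _ B (grow-complete B allEdges [] (∈-allEdges e) compatible)
      where
      compatible : Compatible (extend B) e
      compatible =
        All.lookup (proj₁ ind′) e∈M′ ,
        All.tabulate (λ r∈E → allPairs-∈ separated-sym (proj₂ (isInducedMatching⁻ ind′))
                                e∈M′ (E⊆M′ r∈E) (λ { refl → e∉E r∈E }))

module DeleteEdge {n} (G : Graph n) (u v : Fin n) where

  -- The same test that deleteEdge uses internally, so facts about it transfer definitionally.
  isUV : Fin n → Fin n → Bool
  isUV x y = ((x == u) ∧ (y == v)) ∨ ((x == v) ∧ (y == u))

  isUV⇒endpoints : ∀ {x y} → T (isUV x y) → (x ≡ u × y ≡ v) ⊎ (x ≡ v × y ≡ u)
  isUV⇒endpoints t = Sum.map endpoints endpoints (Equivalence.to T-∨ t)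
    where
    endpoints : ∀ {a b c d : Fin n} → T ((a == c) ∧ (b == d)) → a ≡ c × b ≡ d
    endpoints t with Equivalence.to T-∧ t
    ... | a==c , b==d = ==⇒≡ a==c , ==⇒≡ b==d

  deleteEdge-⊆ : ∀ {x y} → Adj (deleteEdge G u v) x y → Adj G x y
  deleteEdge-⊆ a = Equivalence.to T-≡ (proj₁ (Equivalence.to T-∧ (Equivalence.from T-≡ a)))

  adj⇒adj-deleteEdge : ∀ {x y} → Adj G x y →
    Adj (deleteEdge G u v) x y ⊎ ((x ≡ u × y ≡ v) ⊎ (x ≡ v × y ≡ u))
  adj⇒adj-deleteEdge {x} {y} a with isUV x y in uv
  ... | false = inj₁ (cong (_∧ true) a)
  ... | true  = inj₂ (isUV⇒endpoints (Equivalence.from T-≡ uv))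

  separated-deleteEdge : ∀ {e e′} → Separated G e e′ → Separated (deleteEdge G u v) e e′
  separated-deleteEdge (distinct , (a≁c , a≁d , b≁c , b≁d)) =
    distinct , (a≁c ∘ deleteEdge-⊆ , a≁d ∘ deleteEdge-⊆ , b≁c ∘ deleteEdge-⊆ , b≁d ∘ deleteEdge-⊆)

module CutEdge {n} (G : Graph n) {u v : Fin n} (cut : IsCutEdge G u v) where
  open GraphProperties G
  open DeleteEdge G u v
  open MaximalExtension G

  D : Graph n
  D = deleteEdge G u v

  private module D = GraphProperties D

  Component : Fin n → Set
  Component = Reach D v

  Outside : Fin n → Set
  Outside x = ¬ Component x × x ≢ u

  u∉component : ¬ Component u
  u∉component r = proj₂ cut (D.reach-sym r)

  component-neighbour : ∀ {x y} → Adj G x y → Component y → Component x ⊎ (x ≡ u × y ≡ v)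
  component-neighbour a cy with adj⇒adj-deleteEdge a
  ... | inj₁ d                  = inj₁ (D.reach-snoc cy (D.adj-sym d))
  ... | inj₂ (inj₁ uv)          = inj₂ uv
  ... | inj₂ (inj₂ (_ , refl)) = ⊥-elim (u∉component cy)

  component-closed : ∀ {x y} → Adj G x y → Component y → x ≢ u → Component x
  component-closed a cy x≢u with component-neighbour a cy
  ... | inj₁ cx         = cx
  ... | inj₂ (x≡u , _) = ⊥-elim (x≢u x≡u)

  adj-component : ∀ {x y} → Component x → Component y → Adj G x y → Adj D x y
  adj-component cx cy a with adj⇒adj-deleteEdge a
  ... | inj₁ d                  = d
  ... | inj₂ (inj₁ (refl , _)) = ⊥-elim (u∉component cx)
  ... | inj₂ (inj₂ (_ , refl)) = ⊥-elim (u∉component cy)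

  separated-component : ∀ {e e′} → IsEdgeIn D Component e → IsEdgeIn D Component e′ →
                        Separated D e e′ → Separated G e e′
  separated-component (_ , _ , ca , cb) (_ , _ , cc , cd) (distinct , (a≁c , a≁d , b≁c , b≁d)) =
    distinct , (a≁c ∘ adj-component ca cc , a≁d ∘ adj-component ca cd ,
                b≁c ∘ adj-component cb cc , b≁d ∘ adj-component cb cd)

  outside-far : ∀ {x y} → Outside x → Component y → x ≢ y × ¬ Adj G x y
  outside-far (x∉ , x≢u) cy = (λ { refl → x∉ cy }) , (λ a → x∉ (component-closed a cy x≢u))

  outside-separated : ∀ {a b e} → Outside a → Outside b → IsEdgeIn D Component e → Separated G (a , b) e
  outside-separated oa ob (_ , _ , cc , cd)
    with outside-far oa cc | outside-far oa cd | outside-far ob cc | outside-far ob cd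
  ... | a≢c , a≁c | a≢d , a≁d | b≢c , b≁c | b≢d , b≁d =
    (a≢c , a≢d , b≢c , b≢d) , (a≁c , a≁d , b≁c , b≁d)

  component-edge⇒edge : ∀ {e} → IsEdgeIn D Component e → IsEdgeIn G (λ _ → ⊤) e
  component-edge⇒edge (a , a<b , _ , _) = deleteEdge-⊆ a , a<b , tt , tt

  module _ {c d : Fin n} (fE : IsEdgeIn G (λ _ → ⊤) (c , d)) (oc : Outside c) (od : Outside d)
           (u~cd : Adj G u c ⊎ Adj G u d) where

    separated⇒≢u : ∀ {a b} → Separated G (a , b) (c , d) → a ≢ u × b ≢ u
    separated⇒≢u (_ , (a≁c , a≁d , b≁c , b≁d)) = ≢u a≁c a≁d , ≢u b≁c b≁d
      where
      ≢u : ∀ {x} → ¬ Adj G x c → ¬ Adj G x d → x ≢ u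
      ≢u x≁c x≁d refl = [ x≁c , x≁d ] u~cd

    cons-induced : ∀ {M} → IsInducedMatching D Component M →
                   IsInducedMatching′ (λ _ → ⊤) ((c , d) ∷ M)
    cons-induced {M} (edges , sep) =
      fE ∷ All.map component-edge⇒edge edges ,
      All.map (outside-separated oc od) edges ∷
      lookupPairwise⇒allPairs (λ i j i≢j → separated-component (edge i) (edge j) (sep i j i≢j))
      where
      edge : ∀ i → IsEdgeIn D Component (lookup M i)
      edge i = All.lookup edges (∈-lookup i)

    compatible⇒outside : ∀ {M a b} → IsMaximalInducedMatching D Component M →
      IsEdgeIn G (λ _ → ⊤) (a , b) → All (Separated G (a , b)) ((c , d) ∷ M) → Outside a × Outside b
    compatible⇒outside {M} {a} {b} (ind , maximal) (ab , a<b , _) (sepCD ∷ sepM) =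
      (a∉ , a≢u) , (b∉ , b≢u)
      where
      a≢u : a ≢ u
      a≢u = proj₁ (separated⇒≢u sepCD)
      b≢u : b ≢ u
      b≢u = proj₂ (separated⇒≢u sepCD)
      not-both : Component a → Component b → ⊥
      not-both ca cb = proj₁ (proj₁ (All.lookup sepM ab∈M)) refl
        where
        extended : IsInducedMatching D Component ((a , b) ∷ M)
        extended = D.isInducedMatching⁺
          ((adj-component ca cb ab , a<b , ca , cb) ∷ proj₁ ind ,
           All.map separated-deleteEdge sepM ∷ proj₂ (D.isInducedMatching⁻ ind))
        ab∈M : (a , b) ∈ M
        ab∈M = maximal ((a , b) ∷ M) extended (xs⊆x∷xs M (a , b)) (here refl)
      a∉ : ¬ Component a
      a∉ ca = not-both ca (component-closed (adj-sym ab) ca b≢u)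
      b∉ : ¬ Component b
      b∉ cb = not-both (component-closed ab cb a≢u) cb

    compatible-swap : ∀ {M M′ e} → IsMaximalInducedMatching D Component M →
      IsInducedMatching D Component M′ → IsEdgeIn G (λ _ → ⊤) e →
      All (Separated G e) ((c , d) ∷ M) → All (Separated G e) ((c , d) ∷ M′)
    compatible-swap {e = a , b} mx ind′ eE sep@(sepCD ∷ _) =
      sepCD ∷ All.map (outside-separated oa ob) (proj₁ ind′)
      where
      oa : Outside a
      oa = proj₁ (compatible⇒outside mx eE sep)
      ob : Outside b
      ob = proj₂ (compatible⇒outside mx eE sep)

    component-wellIndumatched′ : WellIndumatched G → WellIndumatchedOn D Component
    component-wellIndumatched′ wi M₁ M₂ m₁ m₂ =
      suc-injective (+-cancelˡ-≡ (length N) _ _ (begin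
        length N + suc (length M₁)  ≡⟨ sym (length-++ N) ⟩
        length (extend (cd ∷ M₁))  ≡⟨ wi _ _ (extend-maximal (cons-induced (proj₁ m₁)))
                                               (extend-maximal (cons-induced (proj₁ m₂))) ⟩
        length (extend (cd ∷ M₂))  ≡⟨ length-++ (grow (cd ∷ M₂) allEdges []) ⟩
        length (grow (cd ∷ M₂) allEdges []) + suc (length M₂)
          ≡⟨ cong (λ N′ → length N′ + suc (length M₂)) (sym same-growth) ⟩
        length N + suc (length M₂)  ∎))
      where
      open ≡-Reasoning
      cd : Edge n
      cd = c , d
      N : List (Edge n)
      N = grow (cd ∷ M₁) allEdges []
      same-growth : N ≡ grow (cd ∷ M₂) allEdges []
      same-growth = grow-cong (compatible-swap m₁ (proj₁ m₂)) (compatible-swap m₂ (proj₁ m₁)) allEdges []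

  component-wellIndumatched : WellIndumatched G → ∀ {c d} → Adj G c d → Adj G u c →
                              Outside c → Outside d → WellIndumatchedOn D Component
  component-wellIndumatched wi c~d u~c oc od with adj⇒edge c~d
  ... | inj₁ cd = component-wellIndumatched′ cd oc od (inj₁ u~c) wi
  ... | inj₂ dc = component-wellIndumatched′ dc od oc (inj₂ u~c) wi

lemma3p3 : ∀ {n} (G : Graph n) (u v : Fin n) →
    Connected G → WellIndumatched G → IsCutEdge G u v →
    (Σ (List (Fin n)) λ p → IsPath G (u ∷ p) × 2 ≤ length p × v ∉ (u ∷ p)) →
    WellIndumatchedOn (deleteEdge G u v) (λ w → Reach (deleteEdge G u v) v w)
lemma3p3 G u v _ _ _ ([] , _ , () , _)
lemma3p3 G u v _ _ _ (_ ∷ [] , _ , s≤s () , _)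
lemma3p3 G u v _ wi cut
         (p₁ ∷ p₂ ∷ _ , (cons u~p₁ (cons p₁~p₂ _) , (u≢p₁ ∷ u≢p₂ ∷ _) ∷ _) , _ , v∉) =
  component-wellIndumatched wi p₁~p₂ u~p₁ (p₁∉ , u≢p₁ ∘ sym) (p₂∉ , u≢p₂ ∘ sym)
  where
  open CutEdge G cut
  p₁∉ : ¬ Component p₁
  p₁∉ cp₁ with component-neighbour u~p₁ cp₁
  ... | inj₁ cu         = u∉component cu
  ... | inj₂ (_ , refl) = v∉ (there (here refl))
  p₂∉ : ¬ Component p₂
  p₂∉ cp₂ = p₁∉ (component-closed p₁~p₂ cp₂ (u≢p₁ ∘ sym))
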